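{- For any graph $G$ and any integer $r\geq 1$, $\mathrm{sn}_r(G)\leq \mathrm{gon}_r(G)$.
   Context: A graph is a finite, connected, undirected multigraph without loops. A vertex set $A$ is $r$-edge-connected if $G[A]$ remains connected after deleting any $r-1$ edges (a single vertex counts). An $r$-scramble $\mathcal{S}$ is a collection of nonempty $r$-edge-connected subsets (eggs) of $V(G)$. A multiset $C$ of vertices $r$-intersects a set $E$ if at least $r$ elements of $C$, counted with multiplicity, lie in $E$. $h_r(\mathcal S)$ is the minimum size of a multiset of vertices that $r$-intersects every egg. An egg-cut is a set of edges whose deletion disconnects $G$ into components at least two of which contain an egg; $e(\mathcal S)$ is the minimum size of an egg-cut. The order is $\|\mathcal S\|_r=\min\{h_r(\mathcal S),e(\mathcal S)\}$, and $\mathrm{sn}_r(G)$ is the maximum order of an $r$-scramble on $G$. Divisors, firing and rank: a divisor is $D=\sum_v D(v)(v)$ with integer coefficients, $\deg D=\sum D(v)$, effective if all $D(v)\ge0$; firing $v$ gives $D'(v)=D(v)-\mathrm{val}(v)$, $D'(w)=D(w)+(\#\text{edges } vw)$; linear equivalence is generated by firings; $r(D)=-1$ if $D$ is not equivalent to an effective divisor, otherwise the largest $r\ge0$ such that $D-E$ is equivalent to an effective divisor for all effective $E$ of degree $r$. $\mathrm{gon}_r(G)$ is the minimum degree of a divisor of rank at least $r$. -}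

module Defs where

open import Data.Nat as ℕ using (ℕ; zero; suc; _≤_)
open import Data.Integer as ℤ using (ℤ; +_)
open import Data.Fin using (Fin; zero; suc; _≟_)
open import Data.Fin.Subset using (Subset; _∈_; _∉_; ⊤; ⊥; ∣_∣; Nonempty)
open import Data.Fin.Subset.Properties using (_∈?_)
open import Data.Product using (Σ; ∃; ∃-syntax; _×_; _,_; proj₁; proj₂)
open import Data.Sum using (_⊎_)
open import Data.Bool using (Bool; true; false; if_then_else_; _∧_; _∨_)
open import Data.List using (List)
open import Data.List.Membership.Propositional using () renaming (_∈_ to _∈ˡ_)
open import Relation.Nullary using (¬_)
open import Relation.Nullary.Decidable using (⌊_⌋)
open import Relation.Binary.PropositionalEquality using (_≡_)

sumF : ∀ {n} → (Fin n → ℕ) → ℕ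
sumF {zero}  f = 0
sumF {suc n} f = f zero ℕ.+ sumF (λ i → f (suc i))

sumFℤ : ∀ {n} → (Fin n → ℤ) → ℤ
sumFℤ {zero}  f = + 0
sumFℤ {suc n} f = f zero ℤ.+ sumFℤ (λ i → f (suc i))

Joins : ∀ {n m} → (Fin m → Fin n × Fin n) → Fin m → Fin n → Fin n → Set
Joins ends e x y = (ends e ≡ (x , y)) ⊎ (ends e ≡ (y , x))

-- Reach ends A F u v : u and v are connected by a walk in G[A] - F
-- (all vertices of the walk lie in A, no edge of the walk lies in F).
data Reach {n m} (ends : Fin m → Fin n × Fin n) (A : Subset n) (F : Subset m)
           : Fin n → Fin n → Set where
  here : ∀ {u} → u ∈ A → Reach ends A F u u
  step : ∀ {u w v} (e : Fin m) → e ∉ F → u ∈ A → w ∈ A →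
         Joins ends e u w → Reach ends A F w v → Reach ends A F u v

record Graph : Set where
  field
    n         : ℕ
    m         : ℕ
    ends      : Fin m → Fin n × Fin n
    loopless  : ∀ e → ¬ (proj₁ (ends e) ≡ proj₂ (ends e))
    nonempty  : Nonempty (⊤ {n})
    connected : ∀ u v → Reach ends ⊤ ⊥ u v

module _ (G : Graph) where
  open Graph G

  Vtx : Set
  Vtx = Fin n

  EdgeConnected : ℕ → Subset n → Set
  EdgeConnected r A = ∀ (F : Subset m) → suc ∣ F ∣ ≤ r →
                      ∀ u v → u ∈ A → v ∈ A → Reach ends A F u v

  record Scramble (r : ℕ) : Set where
    field
      eggs      : List (Subset n)
      eggs-ne   : ∀ E → E ∈ˡ eggs → Nonempty E
      eggs-conn : ∀ E → E ∈ˡ eggs → EdgeConnected r E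
  open Scramble public

  Multiset : Set
  Multiset = Fin n → ℕ

  size : Multiset → ℕ
  size C = sumF C

  restrictCount : Multiset → Subset n → ℕ
  restrictCount C E = sumF (λ v → if ⌊ v ∈? E ⌋ then C v else 0)

  RIntersects : ℕ → Multiset → Subset n → Set
  RIntersects r C E = r ≤ restrictCount C E

  Hits : ∀ {r} → Scramble r → Multiset → Set
  Hits {r} S C = ∀ E → E ∈ˡ eggs S → RIntersects r C E

  EggCut : ∀ {r} → Scramble r → Subset m → Set
  EggCut S F = Σ (Subset n) λ E₁ → Σ (Subset n) λ E₂ →
               E₁ ∈ˡ eggs S × E₂ ∈ˡ eggs S ×
               Σ Vtx λ u → Σ Vtx λ v →
               u ∈ E₁ × v ∈ E₂ ×
               (∀ x → x ∈ E₁ → Reach ends ⊤ F u x) ×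
               (∀ y → y ∈ E₂ → Reach ends ⊤ F v y) ×
               ¬ Reach ends ⊤ F u v

  IsMinOf : (ℕ → Set) → ℕ → Set
  IsMinOf P k = P k × (∀ j → P j → k ≤ j)

  IsMaxOf : (ℕ → Set) → ℕ → Set
  IsMaxOf P k = P k × (∀ j → P j → j ≤ k)

  IsHittingNumber : ∀ {r} → Scramble r → ℕ → Set
  IsHittingNumber S = IsMinOf (λ j → ∃[ C ] (size C ≡ j × Hits S C))

  -- sizes of egg-cuts (e(S) is the minimum of these, ∞ if there are none)
  CutSize : ∀ {r} → Scramble r → ℕ → Set
  CutSize S j = ∃[ F ] (∣ F ∣ ≡ j × EggCut S F)

  IsOrder : ∀ {r} → Scramble r → ℕ → Set
  IsOrder S = IsMinOf (λ j → (∃[ C ] (size C ≡ j × Hits S C)) ⊎ CutSize S j)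

  IsScrambleNumber : ℕ → ℕ → Set
  IsScrambleNumber r = IsMaxOf (λ k → Σ (Scramble r) λ S → IsOrder S k)

  Divisor : Set
  Divisor = Fin n → ℤ

  deg : Divisor → ℤ
  deg D = sumFℤ D

  Effective : Divisor → Set
  Effective D = ∀ v → + 0 ℤ.≤ D v

  mult : Vtx → Vtx → ℕ
  mult v w = sumF (λ e → if (⌊ proj₁ (ends e) ≟ v ⌋ ∧ ⌊ proj₂ (ends e) ≟ w ⌋)
                            ∨ (⌊ proj₁ (ends e) ≟ w ⌋ ∧ ⌊ proj₂ (ends e) ≟ v ⌋)
                         then 1 else 0)

  -- valence (no loops)
  val : Vtx → ℕ
  val v = sumF (mult v)

  fire : Vtx → Divisor → Divisor
  fire v D w = if ⌊ w ≟ v ⌋ then D w ℤ.- + val v else D w ℤ.+ + mult v w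

  data _~_ : Divisor → Divisor → Set where
    ~-pt    : ∀ {D D′} → (∀ w → D w ≡ D′ w) → D ~ D′
    ~-fire  : ∀ D v → D ~ fire v D
    ~-sym   : ∀ {D D′} → D ~ D′ → D′ ~ D
    ~-trans : ∀ {D D′ D″} → D ~ D′ → D′ ~ D″ → D ~ D″

  _-ᴰ_ : Divisor → Multiset → Divisor
  (D -ᴰ E) v = D v ℤ.- + E v

  RankAtLeast : ℕ → Divisor → Set
  RankAtLeast r D = ∀ (E : Multiset) → size E ≡ r →
                    ∃[ D′ ] ((D -ᴰ E) ~ D′ × Effective D′)

  IsGonality : ℕ → ℕ → Set
  IsGonality r g = (∃[ D ] (deg D ≡ + g × RankAtLeast r D))
                 × (∀ D → RankAtLeast r D → + g ℤ.≤ deg D)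

module Submission where

open import Defs
open import Data.Bool using (Bool; true; false; not; if_then_else_; _∧_; _∨_; _xor_)
open import Data.Empty using (⊥-elim)
open import Data.Fin using (Fin; zero; suc; _≟_)
open import Data.Fin.Properties using (suc-injective; any?)
open import Data.Fin.Subset using (Subset; _∈_; _∉_; ⊤; ⊥; ∣_∣; Nonempty)
open import Data.Fin.Subset.Properties using (_∈?_; ∈⊤; ∣⊥∣≡0)
open import Data.Integer using (ℤ; +_; 0ℤ; 1ℤ; +≤+; +<+)
import Data.Integer.Properties as ℤP
open import Data.Integer.Tactic.RingSolver using (solve-∀)
open import Data.List using (List; []; _∷_; map; filter; allFin)
open import Data.List.Membership.Propositional using () renaming (_∈_ to _∈ˡ_)
open import Data.List.Membership.Propositional.Properties using (∈-filter⁺; ∈-allFin)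
open import Data.List.Relation.Unary.All as All using (All; []; _∷_)
open import Data.List.Relation.Unary.All.Properties using (all-filter; map⁻)
open import Data.List.Relation.Unary.Any using (here; there)
open import Data.List.Relation.Unary.Any.Properties using (¬Any[])
open import Data.Nat as ℕ using (ℕ; zero; suc)
import Data.Nat.Properties as ℕP
open import Data.Product using (Σ; ∃-syntax; _×_; _,_; proj₁; proj₂)
open import Data.Sum using (_⊎_; inj₁; inj₂)
open import Data.Vec using (tabulate)
open import Data.Vec.Properties using (lookup∘tabulate; []=⇒lookup; lookup⇒[]=)
open import Relation.Nullary using (¬_)
open import Relation.Nullary.Decidable using (⌊_⌋; yes; no; _×-dec_)
open import Relation.Binary.PropositionalEquality

-- Suppose D has degree g below the order of an r-scramble S and rank at least r.
-- For every vertex v the rank yields an effective P_v ~ D with P_v(v) ≥ r.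
-- Two effective divisors Q and P = Q - Δ f in |D| can be merged: if τ is the
-- largest value of min_E f over the eggs E, then Q - Δ (f - τ)⁺ = P - Δ (τ - f)⁺
-- is effective, and it fails to r-intersect an egg only when f is constant on it,
-- so only when Q and P both fail too. Indeed, an egg meeting both sides of the
-- level τ receives at least r chips through its r edge-disjoint crossings, and an
-- egg lying below τ would make the at most deg Q = g edges leaving {f ≥ τ} an
-- egg-cut. Merging all the P_v gives an effective divisor of degree g that
-- r-intersects every egg E, as P_v does for v ∈ E: a hitting multiset of size g.

module Summation where
  open Data.Integer using (-_; _+_; _-_; _≤_)

  keepIf : Bool → ℤ → ℤ
  keepIf t x = if t then x else 0ℤ

  keepIf-0 : ∀ t → keepIf t 0ℤ ≡ 0ℤ
  keepIf-0 true  = refl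
  keepIf-0 false = refl

  keepIf-+ : ∀ t x y → keepIf t (x + y) ≡ keepIf t x + keepIf t y
  keepIf-+ true  x y = refl
  keepIf-+ false x y = refl

  keepIf-minus : ∀ t x y → keepIf t (x - y) ≡ keepIf t x - keepIf t y
  keepIf-minus true  x y = refl
  keepIf-minus false x y = refl

  ∑-cong : ∀ {n} {f g : Fin n → ℤ} → (∀ i → f i ≡ g i) → sumFℤ f ≡ sumFℤ g
  ∑-cong {zero}  f≗g = refl
  ∑-cong {suc n} f≗g = cong₂ _+_ (f≗g zero) (∑-cong (λ i → f≗g (suc i)))

  ∑-0 : ∀ {n} → sumFℤ {n} (λ _ → 0ℤ) ≡ 0ℤ
  ∑-0 {zero}  = refl
  ∑-0 {suc n} = trans (ℤP.+-identityˡ (sumFℤ {n} (λ _ → 0ℤ))) (∑-0 {n})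

  ∑-+ : ∀ {n} (f g : Fin n → ℤ) → sumFℤ (λ i → f i + g i) ≡ sumFℤ f + sumFℤ g
  ∑-+ {zero}  f g = refl
  ∑-+ {suc n} f g = begin
    f zero + g zero + sumFℤ (λ i → f (suc i) + g (suc i))
      ≡⟨ cong (_+_ (f zero + g zero)) (∑-+ (λ i → f (suc i)) (λ i → g (suc i))) ⟩
    f zero + g zero + (sumFℤ (λ i → f (suc i)) + sumFℤ (λ i → g (suc i)))
      ≡⟨ interchange (f zero) (g zero) _ _ ⟩
    f zero + sumFℤ (λ i → f (suc i)) + (g zero + sumFℤ (λ i → g (suc i)))
      ∎
    where
    open ≡-Reasoning
    interchange : ∀ a b c d → a + b + (c + d) ≡ a + c + (b + d)
    interchange = solve-∀

  ∑-neg : ∀ {n} (f : Fin n → ℤ) → sumFℤ (λ i → - f i) ≡ - sumFℤ f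
  ∑-neg {zero}  f = refl
  ∑-neg {suc n} f = trans (cong (_+_ (- f zero)) (∑-neg (λ i → f (suc i))))
                          (sym (ℤP.neg-distrib-+ (f zero) _))

  ∑-minus : ∀ {n} (f g : Fin n → ℤ) → sumFℤ (λ i → f i - g i) ≡ sumFℤ f - sumFℤ g
  ∑-minus f g = trans (∑-+ f (λ i → - g i)) (cong (_+_ (sumFℤ f)) (∑-neg g))

  ∑-mono-≤ : ∀ {n} {f g : Fin n → ℤ} → (∀ i → f i ≤ g i) → sumFℤ f ≤ sumFℤ g
  ∑-mono-≤ {zero}  f≤g = ℤP.≤-refl
  ∑-mono-≤ {suc n} f≤g = ℤP.+-mono-≤ (f≤g zero) (∑-mono-≤ (λ i → f≤g (suc i)))

  ∑-comm : ∀ {n m} (h : Fin n → Fin m → ℤ) →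
           sumFℤ (λ i → sumFℤ (h i)) ≡ sumFℤ (λ j → sumFℤ (λ i → h i j))
  ∑-comm {zero}  {m} h = sym (∑-0 {m})
  ∑-comm {suc n} {m} h =
    trans (cong (_+_ (sumFℤ (h zero))) (∑-comm (λ i → h (suc i))))
          (sym (∑-+ (h zero) (λ j → sumFℤ (λ i → h (suc i) j))))

  ∑-pos : ∀ {n} (f : Fin n → ℕ) → sumFℤ (λ i → + f i) ≡ + sumF f
  ∑-pos {zero}  f = refl
  ∑-pos {suc n} f = trans (cong (_+_ (+ f zero)) (∑-pos (λ i → f (suc i))))
                          (sym (ℤP.pos-+ (f zero) _))

  ∑-keepIf : ∀ {n} t (f : Fin n → ℤ) → sumFℤ (λ i → keepIf t (f i)) ≡ keepIf t (sumFℤ f)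
  ∑-keepIf     true  f = refl
  ∑-keepIf {n} false f = ∑-0 {n}

  ≟-suc : ∀ {n} (b x : Fin n) → ⌊ suc b ≟ suc x ⌋ ≡ ⌊ b ≟ x ⌋
  ≟-suc b x with suc b ≟ suc x | b ≟ x
  ... | yes _     | yes _   = refl
  ... | no  _     | no  _   = refl
  ... | yes sb≡sx | no  b≢x = ⊥-elim (b≢x (suc-injective sb≡sx))
  ... | no  sb≢sx | yes b≡x = ⊥-elim (sb≢sx (cong suc b≡x))

  ∑-point : ∀ {n} (b : Fin n) (c : ℤ) → sumFℤ (λ x → keepIf ⌊ b ≟ x ⌋ c) ≡ c
  ∑-point {suc n} zero    c = trans (cong (_+_ c) (∑-0 {n})) (ℤP.+-identityʳ c)
  ∑-point {suc n} (suc b) c = begin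
    0ℤ + sumFℤ (λ x → keepIf ⌊ suc b ≟ suc x ⌋ c) ≡⟨ ℤP.+-identityˡ _ ⟩
    sumFℤ (λ x → keepIf ⌊ suc b ≟ suc x ⌋ c)
      ≡⟨ ∑-cong (λ x → cong (λ t → keepIf t c) (≟-suc b x)) ⟩
    sumFℤ (λ x → keepIf ⌊ b ≟ x ⌋ c)              ≡⟨ ∑-point b c ⟩
    c                                              ∎
    where open ≡-Reasoning

  term≤∑ : ∀ {n} (f : Fin n → ℤ) → (∀ i → 0ℤ ≤ f i) → ∀ j → f j ≤ sumFℤ f
  term≤∑ {n} f f≥0 j = subst (_≤ sumFℤ f) (∑-point j (f j)) (∑-mono-≤ {n} term)
    where
    term : ∀ i → keepIf ⌊ j ≟ i ⌋ (f j) ≤ f i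
    term i with j ≟ i
    ... | yes refl = ℤP.≤-refl
    ... | no  _    = f≥0 i

module Laplacian (G : Graph) where
  open Graph G
  open Summation
  open Data.Integer using (-_; _+_; _-_; _≤_)

  src tgt : Fin m → Fin n
  src e = proj₁ (ends e)
  tgt e = proj₂ (ends e)

  outflow : (Fin n → Bool) → (Fin n → ℤ) → Fin m → ℤ
  outflow A f e = keepIf (A (src e)) (f (src e) - f (tgt e))
                + keepIf (A (tgt e)) (f (tgt e) - f (src e))

  -- Δ f w sums f w - f x over the edges from w to x, so firing v subtracts Δ (unit v).
  Δₑ : (Fin n → ℤ) → Fin m → Fin n → ℤ
  Δₑ f e w = outflow (λ x → ⌊ x ≟ w ⌋) f e

  Δ : (Fin n → ℤ) → Fin n → ℤ
  Δ f w = sumFℤ (λ e → Δₑ f e w)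

  Δ-affine : ∀ f a b c → (∀ x → f x ≡ c + a x - b x) →
             ∀ w → Δ f w ≡ Δ a w - Δ b w
  Δ-affine f a b c f≡ w = trans (∑-cong edge) (∑-minus (λ e → Δₑ a e w) (λ e → Δₑ b e w))
    where
    differences : ∀ x y → f x - f y ≡ (a x - a y) - (b x - b y)
    differences x y = trans (cong₂ _-_ (f≡ x) (f≡ y)) (cancel c (a x) (b x) (a y) (b y))
      where
      cancel : ∀ c ax bx ay by → (c + ax - bx) - (c + ay - by) ≡ (ax - ay) - (bx - by)
      cancel = solve-∀
    regroup : ∀ p q s t → (p - q) + (s - t) ≡ (p + s) - (q + t)
    regroup = solve-∀
    edge : ∀ e → Δₑ f e w ≡ Δₑ a e w - Δₑ b e w
    edge e = begin
      keepIf S (f s - f t) + keepIf T (f t - f s)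
        ≡⟨ cong₂ (λ p q → keepIf S p + keepIf T q) (differences s t) (differences t s) ⟩
      keepIf S ((a s - a t) - (b s - b t)) + keepIf T ((a t - a s) - (b t - b s))
        ≡⟨ cong₂ _+_ (keepIf-minus S _ _) (keepIf-minus T _ _) ⟩
      (keepIf S (a s - a t) - keepIf S (b s - b t)) + (keepIf T (a t - a s) - keepIf T (b t - b s))
        ≡⟨ regroup (keepIf S (a s - a t)) (keepIf S (b s - b t)) (keepIf T (a t - a s)) (keepIf T (b t - b s)) ⟩
      Δₑ a e w - Δₑ b e w
        ∎
      where
      open ≡-Reasoning
      s = src e
      t = tgt e
      S = ⌊ s ≟ w ⌋
      T = ⌊ t ≟ w ⌋

  Δ-0 : ∀ w → Δ (λ _ → 0ℤ) w ≡ 0ℤ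
  Δ-0 w = trans (∑-cong (λ e → cong₂ _+_ (keepIf-0 ⌊ src e ≟ w ⌋) (keepIf-0 ⌊ tgt e ≟ w ⌋)))
                (∑-0 {m})

  Δ-neg : ∀ a w → Δ (λ x → - a x) w ≡ - Δ a w
  Δ-neg a w = begin
    Δ (λ x → - a x) w          ≡⟨ Δ-affine (λ x → - a x) (λ _ → 0ℤ) a 0ℤ (λ x → negate (a x)) w ⟩
    Δ (λ _ → 0ℤ) w - Δ a w     ≡⟨ cong (_- Δ a w) (Δ-0 w) ⟩
    0ℤ - Δ a w                 ≡⟨ ℤP.+-identityˡ _ ⟩
    - Δ a w                    ∎
    where
    open ≡-Reasoning
    negate : ∀ x → - x ≡ 0ℤ + 0ℤ - x
    negate = solve-∀

  Δ-+ : ∀ a b w → Δ (λ x → a x + b x) w ≡ Δ a w + Δ b w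
  Δ-+ a b w = begin
    Δ (λ x → a x + b x) w
      ≡⟨ Δ-affine (λ x → a x + b x) a (λ x → - b x) 0ℤ (λ x → add (a x) (b x)) w ⟩
    Δ a w - Δ (λ x → - b x) w      ≡⟨ cong (λ t → Δ a w - t) (Δ-neg b w) ⟩
    Δ a w - - Δ b w                ≡⟨ cong (_+_ (Δ a w)) (ℤP.neg-involutive (Δ b w)) ⟩
    Δ a w + Δ b w                  ∎
    where
    open ≡-Reasoning
    add : ∀ x y → x + y ≡ 0ℤ + x - (- y)
    add = solve-∀

  ∑-outflow : ∀ (A : Fin n → Bool) f →
              sumFℤ (λ w → keepIf (A w) (Δ f w)) ≡ sumFℤ (outflow A f)
  ∑-outflow A f = begin
    sumFℤ (λ w → keepIf (A w) (Δ f w))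
      ≡⟨ ∑-cong (λ w → sym (∑-keepIf (A w) (λ e → Δₑ f e w))) ⟩
    sumFℤ (λ w → sumFℤ (λ e → keepIf (A w) (Δₑ f e w)))
      ≡⟨ ∑-comm {n} {m} (λ w e → keepIf (A w) (Δₑ f e w)) ⟩
    sumFℤ (λ e → sumFℤ (λ w → keepIf (A w) (Δₑ f e w)))
      ≡⟨ ∑-cong edge ⟩
    sumFℤ (outflow A f)
      ∎
    where
    open ≡-Reasoning
    atEnd : ∀ a w X → keepIf (A w) (keepIf ⌊ a ≟ w ⌋ X) ≡ keepIf ⌊ a ≟ w ⌋ (keepIf (A a) X)
    atEnd a w X with a ≟ w
    ... | yes refl = refl
    ... | no  _    = keepIf-0 (A w)
    edge : ∀ e → sumFℤ (λ w → keepIf (A w) (Δₑ f e w)) ≡ outflow A f e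
    edge e = begin
      sumFℤ (λ w → keepIf (A w) (Δₑ f e w))
        ≡⟨ ∑-cong (λ w → trans (keepIf-+ (A w) _ _) (cong₂ _+_ (atEnd s w _) (atEnd t w _))) ⟩
      sumFℤ (λ w → keepIf ⌊ s ≟ w ⌋ (keepIf (A s) (f s - f t))
                 + keepIf ⌊ t ≟ w ⌋ (keepIf (A t) (f t - f s)))
        ≡⟨ ∑-+ (λ w → keepIf ⌊ s ≟ w ⌋ _) (λ w → keepIf ⌊ t ≟ w ⌋ _) ⟩
      sumFℤ (λ w → keepIf ⌊ s ≟ w ⌋ (keepIf (A s) (f s - f t)))
        + sumFℤ (λ w → keepIf ⌊ t ≟ w ⌋ (keepIf (A t) (f t - f s)))
        ≡⟨ cong₂ _+_ (∑-point s _) (∑-point t _) ⟩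
      outflow A f e
        ∎
      where
      s = src e
      t = tgt e

  ∑-Δ : ∀ f → sumFℤ (Δ f) ≡ 0ℤ
  ∑-Δ f = trans (∑-outflow (λ _ → true) f) (trans (∑-cong cancel) (∑-0 {m}))
    where
    opposite : ∀ x y → (x - y) + (y - x) ≡ 0ℤ
    opposite = solve-∀
    cancel : ∀ e → outflow (λ _ → true) f e ≡ 0ℤ
    cancel e = opposite (f (src e)) (f (tgt e))

  Δ-nonpos-at-minimum : ∀ h w → (∀ x → h w ≤ h x) → Δ h w ≤ 0ℤ
  Δ-nonpos-at-minimum h w minimal =
    subst (Δ h w ≤_) (∑-0 {m}) (∑-mono-≤ (λ e → ℤP.+-mono-≤ (atEnd (src e) (tgt e)) (atEnd (tgt e) (src e))))
    where
    atEnd : ∀ a b → keepIf ⌊ a ≟ w ⌋ (h a - h b) ≤ 0ℤ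
    atEnd a b with a ≟ w
    ... | yes refl = ℤP.i≤j⇒i-j≤0 (minimal b)
    ... | no  _    = ℤP.≤-refl

  unit : Fin n → Fin n → ℤ
  unit v x = keepIf ⌊ x ≟ v ⌋ 1ℤ

  private
    incidence : Fin m → Fin n → Fin n → ℕ
    incidence e v w = if (⌊ src e ≟ v ⌋ ∧ ⌊ tgt e ≟ w ⌋) ∨ (⌊ src e ≟ w ⌋ ∧ ⌊ tgt e ≟ v ⌋)
                      then 1 else 0

    Δₑ-unit-off : ∀ e v w → ¬ w ≡ v → Δₑ (unit v) e w ≡ - + incidence e v w
    Δₑ-unit-off e v w w≢v with src e ≟ v | src e ≟ w | tgt e ≟ v | tgt e ≟ w
    ... | yes p | yes q | _     | _     = ⊥-elim (w≢v (trans (sym q) p))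
    ... | _     | _     | yes p | yes q = ⊥-elim (w≢v (trans (sym q) p))
    ... | yes _ | no  _ | no  _ | yes _ = refl
    ... | yes _ | no  _ | yes _ | no  _ = refl
    ... | yes _ | no  _ | no  _ | no  _ = refl
    ... | no  _ | yes _ | no  _ | yes _ = refl
    ... | no  _ | yes _ | yes _ | no  _ = refl
    ... | no  _ | yes _ | no  _ | no  _ = refl
    ... | no  _ | no  _ | no  _ | yes _ = refl
    ... | no  _ | no  _ | yes _ | no  _ = refl
    ... | no  _ | no  _ | no  _ | no  _ = refl

    Δₑ-unit-on : ∀ e v → Δₑ (unit v) e v ≡ keepIf ⌊ src e ≟ v ⌋ 1ℤ + keepIf ⌊ tgt e ≟ v ⌋ 1ℤ
    Δₑ-unit-on e v with src e ≟ v | tgt e ≟ v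
    ... | yes p | yes q = ⊥-elim (loopless e (trans p (sym q)))
    ... | yes _ | no  _ = refl
    ... | no  _ | yes _ = refl
    ... | no  _ | no  _ = refl

    incidence-split : ∀ e v x →
      + incidence e v x ≡ keepIf ⌊ src e ≟ v ⌋ (keepIf ⌊ tgt e ≟ x ⌋ 1ℤ)
                        + keepIf ⌊ tgt e ≟ v ⌋ (keepIf ⌊ src e ≟ x ⌋ 1ℤ)
    incidence-split e v x with src e ≟ v | tgt e ≟ x | src e ≟ x | tgt e ≟ v
    ... | yes p | _     | _     | yes q = ⊥-elim (loopless e (trans p (sym q)))
    ... | _     | yes p | yes q | _     = ⊥-elim (loopless e (trans q (sym p)))
    ... | yes _ | yes _ | no  _ | no  _ = refl
    ... | yes _ | no  _ | yes _ | no  _ = refl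
    ... | yes _ | no  _ | no  _ | no  _ = refl
    ... | no  _ | yes _ | no  _ | yes _ = refl
    ... | no  _ | yes _ | no  _ | no  _ = refl
    ... | no  _ | no  _ | yes _ | yes _ = refl
    ... | no  _ | no  _ | yes _ | no  _ = refl
    ... | no  _ | no  _ | no  _ | yes _ = refl
    ... | no  _ | no  _ | no  _ | no  _ = refl

    valence-edges : ∀ e v → sumFℤ (λ x → + incidence e v x)
                            ≡ keepIf ⌊ src e ≟ v ⌋ 1ℤ + keepIf ⌊ tgt e ≟ v ⌋ 1ℤ
    valence-edges e v = begin
      sumFℤ (λ x → + incidence e v x)
        ≡⟨ ∑-cong (incidence-split e v) ⟩
      sumFℤ (λ x → keepIf S (at-tgt x) + keepIf T (at-src x))
        ≡⟨ ∑-+ (λ x → keepIf S (at-tgt x)) (λ x → keepIf T (at-src x)) ⟩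
      sumFℤ (λ x → keepIf S (at-tgt x)) + sumFℤ (λ x → keepIf T (at-src x))
        ≡⟨ cong₂ _+_ (∑-keepIf S at-tgt) (∑-keepIf T at-src) ⟩
      keepIf S (sumFℤ at-tgt) + keepIf T (sumFℤ at-src)
        ≡⟨ cong₂ _+_ (cong (keepIf S) (∑-point (tgt e) 1ℤ)) (cong (keepIf T) (∑-point (src e) 1ℤ)) ⟩
      keepIf S 1ℤ + keepIf T 1ℤ
        ∎
      where
      open ≡-Reasoning
      S = ⌊ src e ≟ v ⌋
      T = ⌊ tgt e ≟ v ⌋
      at-src at-tgt : Fin n → ℤ
      at-src x = keepIf ⌊ src e ≟ x ⌋ 1ℤ
      at-tgt x = keepIf ⌊ tgt e ≟ x ⌋ 1ℤ

  Δ-unit-off : ∀ v w → ¬ w ≡ v → Δ (unit v) w ≡ - + mult G v w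
  Δ-unit-off v w w≢v = begin
    Δ (unit v) w                             ≡⟨ ∑-cong (λ e → Δₑ-unit-off e v w w≢v) ⟩
    sumFℤ (λ e → - + incidence e v w)        ≡⟨ ∑-neg (λ e → + incidence e v w) ⟩
    - sumFℤ (λ e → + incidence e v w)        ≡⟨ cong -_ (∑-pos (λ e → incidence e v w)) ⟩
    - + mult G v w                           ∎
    where open ≡-Reasoning

  Δ-unit-on : ∀ v → Δ (unit v) v ≡ + val G v
  Δ-unit-on v = begin
    Δ (unit v) v
      ≡⟨ ∑-cong (λ e → Δₑ-unit-on e v) ⟩
    sumFℤ (λ e → keepIf ⌊ src e ≟ v ⌋ 1ℤ + keepIf ⌊ tgt e ≟ v ⌋ 1ℤ)
      ≡⟨ ∑-cong (λ e → sym (valence-edges e v)) ⟩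
    sumFℤ (λ e → sumFℤ (λ x → + incidence e v x))
      ≡⟨ ∑-comm {m} {n} (λ e x → + incidence e v x) ⟩
    sumFℤ (λ x → sumFℤ (λ e → + incidence e v x))
      ≡⟨ ∑-cong (λ x → ∑-pos (λ e → incidence e v x)) ⟩
    sumFℤ (λ x → + mult G v x)
      ≡⟨ ∑-pos (mult G v) ⟩
    + val G v
      ∎
    where open ≡-Reasoning

  fire≡Δ : ∀ v D w → fire G v D w ≡ D w - Δ (unit v) w
  fire≡Δ v D w with w ≟ v
  ... | yes refl = cong (_-_ (D w)) (sym (Δ-unit-on w))
  ... | no  w≢v  = cong (_+_ (D w)) (trans (sym (ℤP.neg-involutive (+ mult G v w)))
                                        (cong -_ (sym (Δ-unit-off v w w≢v))))

  ~⇒Δ : ∀ {D D′} → _~_ G D D′ → Σ (Fin n → ℤ) λ f → ∀ w → D′ w ≡ D w - Δ f w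
  ~⇒Δ {D} {D′} (~-pt D≗D′) = (λ _ → 0ℤ) , λ w → begin
    D′ w ≡⟨ sym (D≗D′ w) ⟩
    D w ≡⟨ sym (ℤP.+-identityʳ (D w)) ⟩
    D w - 0ℤ ≡⟨ cong (_-_ (D w)) (sym (Δ-0 w)) ⟩
    D w - Δ (λ _ → 0ℤ) w ∎
    where open ≡-Reasoning
  ~⇒Δ (~-fire D v) = unit v , fire≡Δ v D
  ~⇒Δ {D} {D′} (~-sym D′~D) with ~⇒Δ D′~D
  ... | f , D≡ = (λ x → - f x) , λ w → begin
    D′ w                       ≡⟨ undo (D′ w) (Δ f w) ⟩
    (D′ w - Δ f w) - - Δ f w   ≡⟨ cong₂ _-_ (sym (D≡ w)) (sym (Δ-neg f w)) ⟩
    D w - Δ (λ x → - f x) w    ∎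
    where
    open ≡-Reasoning
    undo : ∀ a b → a ≡ (a - b) - - b
    undo = solve-∀
  ~⇒Δ {D} {D″} (~-trans {D′ = D′} D~D′ D′~D″) with ~⇒Δ D~D′ | ~⇒Δ D′~D″
  ... | f , D′≡ | g , D″≡ = (λ x → f x + g x) , λ w → begin
    D″ w                         ≡⟨ D″≡ w ⟩
    D′ w - Δ g w                 ≡⟨ cong (_- Δ g w) (D′≡ w) ⟩
    (D w - Δ f w) - Δ g w        ≡⟨ assoc (D w) (Δ f w) (Δ g w) ⟩
    D w - (Δ f w + Δ g w)        ≡⟨ cong (_-_ (D w)) (sym (Δ-+ f g w)) ⟩
    D w - Δ (λ x → f x + g x) w  ∎
    where
    open ≡-Reasoning
    assoc : ∀ a b c → (a - b) - c ≡ a - (b + c)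
    assoc = solve-∀

module Cuts (G : Graph) where
  open Graph G
  open Summation
  open Laplacian G using (src; tgt)
  open Data.Integer using (_+_)

  select : ∀ {k} → (Fin k → Bool) → Subset k
  select = tabulate

  ∈-select : ∀ {k} (φ : Fin k → Bool) {x} → φ x ≡ true → x ∈ select φ
  ∈-select φ {x} φx = lookup⇒[]= x (tabulate φ) (trans (lookup∘tabulate φ x) φx)

  ∉-select : ∀ {k} (φ : Fin k → Bool) {x} → φ x ≡ false → x ∉ select φ
  ∉-select φ {x} φx x∈ with trans (sym φx) (trans (sym (lookup∘tabulate φ x)) ([]=⇒lookup x∈))
  ... | ()

  ∣select∣ : ∀ {k} (φ : Fin k → Bool) → + ∣ select φ ∣ ≡ sumFℤ (λ e → keepIf (φ e) 1ℤ)
  ∣select∣ {zero}  φ = refl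
  ∣select∣ {suc k} φ with φ zero
  ... | true  = cong (_+_ 1ℤ) (∣select∣ (λ e → φ (suc e)))
  ... | false = trans (∣select∣ (λ e → φ (suc e))) (sym (ℤP.+-identityˡ _))

  inside : Subset n → Fin n → Bool
  inside Y v = ⌊ v ∈? Y ⌋

  inside-∈ : ∀ {Y v} → v ∈ Y → inside Y v ≡ true
  inside-∈ {Y} {v} v∈Y with v ∈? Y
  ... | yes _   = refl
  ... | no  v∉Y = ⊥-elim (v∉Y v∈Y)

  crossing : (A P : Fin n → Bool) → Fin m → Bool
  crossing A P e = A (src e) ∧ A (tgt e) ∧ (P (src e) xor P (tgt e))

  private
    joins-ends : ∀ {e x z} → Joins ends e x z →
                 (src e ≡ x × tgt e ≡ z) ⊎ (src e ≡ z × tgt e ≡ x)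
    joins-ends (inj₁ refl) = inj₁ (refl , refl)
    joins-ends (inj₂ refl) = inj₂ (refl , refl)

    xor-≡ : ∀ {a b} → a ≡ b → (a xor b) ≡ false
    xor-≡ {true}  refl = refl
    xor-≡ {false} refl = refl

    ∧-false : ∀ a b {c} → c ≡ false → a ∧ b ∧ c ≡ false
    ∧-false true  true  c≡false = c≡false
    ∧-false true  false _       = refl
    ∧-false false _     _       = refl

  crossing-joins : ∀ {A P e x z} → Joins ends e x z → A x ≡ true → A z ≡ true →
                   P x ≡ false → P z ≡ true → crossing A P e ≡ true
  crossing-joins J Ax Az Px Pz with joins-ends J
  ... | inj₁ (refl , refl) rewrite Ax | Az | Px | Pz = refl
  ... | inj₂ (refl , refl) rewrite Ax | Az | Px | Pz = refl

  ¬crossing-joins : ∀ {A P e x z} → Joins ends e x z → P x ≡ P z → crossing A P e ≡ false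
  ¬crossing-joins {A} {P} {e} J Px≡Pz with joins-ends J
  ... | inj₁ (refl , refl) = ∧-false (A (src e)) (A (tgt e)) (xor-≡ Px≡Pz)
  ... | inj₂ (refl , refl) = ∧-false (A (src e)) (A (tgt e)) (xor-≡ (sym Px≡Pz))

  walk-crosses : ∀ {A F u v} (P : Fin n → Bool) → Reach ends A F u v → P u ≡ false → P v ≡ true →
    Σ (Fin m) λ e → Σ (Fin n) λ x → Σ (Fin n) λ z →
      e ∉ F × x ∈ A × z ∈ A × Joins ends e x z × P x ≡ false × P z ≡ true
  walk-crosses P (here _) Pu Pv with trans (sym Pu) Pv
  ... | ()
  walk-crosses P (step {u} {w} e e∉F u∈A w∈A J rest) Pu Pv with P w in Pw
  ... | true  = e , u , w , e∉F , u∈A , w∈A , J , Pu , Pw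
  ... | false = walk-crosses P rest Pw Pv

  reach-mono : ∀ {A A′ F F′ u v} → (∀ x → x ∈ A → x ∈ A′) →
    (∀ e x z → e ∉ F → x ∈ A → z ∈ A → Joins ends e x z → e ∉ F′) →
    Reach ends A F u v → Reach ends A′ F′ u v
  reach-mono A⊆A′ keep (here u∈A) = here (A⊆A′ _ u∈A)
  reach-mono A⊆A′ keep (step e e∉F u∈A w∈A J rest) =
    step e (keep e _ _ e∉F u∈A w∈A J) (A⊆A′ _ u∈A) (A⊆A′ _ w∈A) J (reach-mono A⊆A′ keep rest)

  r≤∣crossing∣ : ∀ {r Y} (P : Fin n → Bool) → EdgeConnected G r Y → ∀ {y y′} → y ∈ Y → y′ ∈ Y →
                 P y ≡ false → P y′ ≡ true → r ℕ.≤ ∣ select (crossing (inside Y) P) ∣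
  r≤∣crossing∣ {r} {Y} P conn y∈Y y′∈Y Py Py′ with r ℕP.≤? ∣ select (crossing (inside Y) P) ∣
  ... | yes r≤∣F∣ = r≤∣F∣
  ... | no  r≰∣F∣ with walk-crosses P (conn _ (ℕP.≰⇒> r≰∣F∣) _ _ y∈Y y′∈Y) Py Py′
  ... | e , x , z , e∉F , x∈Y , z∈Y , J , Px , Pz =
    ⊥-elim (e∉F (∈-select _ (crossing-joins J (inside-∈ x∈Y) (inside-∈ z∈Y) Px Pz)))

  levelCut : (Fin n → Bool) → Subset m
  levelCut P = select (crossing (λ _ → true) P)

  levelCut-separates : ∀ P {u v} → P u ≡ false → P v ≡ true → ¬ Reach ends ⊤ (levelCut P) u v
  levelCut-separates P Pu Pv walk with walk-crosses P walk Pu Pv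
  ... | e , x , z , e∉F , _ , _ , J , Px , Pz = e∉F (∈-select _ (crossing-joins J refl refl Px Pz))

  levelCut-within : ∀ {r Y} P b → 1 ℕ.≤ r → EdgeConnected G r Y → (∀ z → z ∈ Y → P z ≡ b) →
                    ∀ {u x} → u ∈ Y → x ∈ Y → Reach ends ⊤ (levelCut P) u x
  levelCut-within {r} {Y} P b 1≤r conn P≡b u∈Y x∈Y =
    reach-mono (λ _ _ → ∈⊤) avoid (conn ⊥ 1≤r′ _ _ u∈Y x∈Y)
    where
    1≤r′ : suc ∣ ⊥ {m} ∣ ℕ.≤ r
    1≤r′ = subst (λ k → suc k ℕ.≤ r) (sym (∣⊥∣≡0 m)) 1≤r
    avoid : ∀ e x z → e ∉ ⊥ → x ∈ Y → z ∈ Y → Joins ends e x z → e ∉ levelCut P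
    avoid e x z _ x∈Y z∈Y J =
      ∉-select _ (¬crossing-joins {A = λ _ → true} J (trans (P≡b x x∈Y) (sym (P≡b z z∈Y))))

module Threshold {n : ℕ} (f : Fin n → ℤ) where
  open Data.Integer using (_≤_)
  open import Data.List.Extrema ℤP.≤-totalOrder using (argmin; argmin-all; f[argmin]≤f[xs])

  lowest : ∀ {Y} → Nonempty Y → Σ (Fin n) λ y → y ∈ Y × (∀ z → z ∈ Y → f y ≤ f z)
  lowest {Y} (y , y∈Y) =
    argmin f y members ,
    argmin-all f y∈Y (all-filter (_∈? Y) (allFin n)) ,
    λ z z∈Y → All.lookup (f[argmin]≤f[xs] y members) (∈-filter⁺ (_∈? Y) (∈-allFin z) z∈Y)
    where
    members = filter (_∈? Y) (allFin n)

  -- τ is the maximum over the sets of the minimum of f on each of them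
  IsThreshold : List (Subset n) → ℤ → Set
  IsThreshold Ys τ = (∀ Y → Y ∈ˡ Ys → ∃[ y ] y ∈ Y × f y ≤ τ)
                   × (∃[ Y ] Y ∈ˡ Ys × (∀ y → y ∈ Y → τ ≤ f y))

  threshold : ∀ Y Ys → Nonempty Y → (∀ Y′ → Y′ ∈ˡ Ys → Nonempty Y′) →
              ∃[ τ ] IsThreshold (Y ∷ Ys) τ
  threshold Y [] neY _ with lowest neY
  ... | y , y∈Y , y-min = f y , (λ { _ (here refl) → y , y∈Y , ℤP.≤-refl }) , (Y , here refl , y-min)
  threshold Y (Y₁ ∷ Ys) neY neYs with threshold Y₁ Ys (neYs Y₁ (here refl)) (λ Y′ p → neYs Y′ (there p))
                                 | lowest neY
  ... | τ , low , (Ŷ , Ŷ∈ , Ŷ-high) | y , y∈Y , y-min with ℤP.≤-total τ (f y)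
  ... | inj₁ τ≤fy = f y , low′ , (Y , here refl , y-min)
    where
    low′ : ∀ Y′ → Y′ ∈ˡ Y ∷ Y₁ ∷ Ys → ∃[ z ] z ∈ Y′ × f z ≤ f y
    low′ _  (here refl) = y , y∈Y , ℤP.≤-refl
    low′ Y′ (there p) with low Y′ p
    ... | z , z∈Y′ , fz≤τ = z , z∈Y′ , ℤP.≤-trans fz≤τ τ≤fy
  ... | inj₂ fy≤τ = τ , low′ , (Ŷ , there Ŷ∈ , Ŷ-high)
    where
    low′ : ∀ Y′ → Y′ ∈ˡ Y ∷ Y₁ ∷ Ys → ∃[ z ] z ∈ Y′ × f z ≤ τ
    low′ _  (here refl) = y , y∈Y , fy≤τ
    low′ Y′ (there p) = low Y′ p

module Truncation (G : Graph) where
  open Graph G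
  open Summation
  open Laplacian G
  open Cuts G
  open Data.Integer using (-_; _+_; _-_; _≤_; _<_; _⊔_)

  private
    <⇒0<- : ∀ {i j} → i < j → 0ℤ < j - i
    <⇒0<- {i} {j} i<j = subst (_< j - i) (ℤP.+-inverseʳ i) (ℤP.+-monoˡ-< (- i) i<j)

    <⇒1≤- : ∀ {i j} → i < j → 1ℤ ≤ j - i
    <⇒1≤- {i} {j} i<j = subst (_≤ j - i) (cancel i) (ℤP.+-monoˡ-≤ (- i) (ℤP.i<j⇒suc[i]≤j i<j))
      where
      cancel : ∀ i → (1ℤ + i) - i ≡ 1ℤ
      cancel = solve-∀

    ≤-minus-nonpos : ∀ i {j} → j ≤ 0ℤ → i ≤ i - j
    ≤-minus-nonpos i {j} j≤0 = subst (_≤ i - j) (ℤP.+-identityʳ i) (ℤP.+-monoʳ-≤ i (ℤP.neg-mono-≤ j≤0))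

    ⊔0-nonneg : ∀ i → 0ℤ ≤ i ⊔ 0ℤ
    ⊔0-nonneg i = ℤP.i≤j⊔i i 0ℤ

    ⊔0-split : ∀ i → i ≡ (i ⊔ 0ℤ) - ((- i) ⊔ 0ℤ)
    ⊔0-split i with ℤP.≤-total i 0ℤ
    ... | inj₁ i≤0 = begin
      i                  ≡⟨ sym (ℤP.neg-involutive i) ⟩
      - (- i)            ≡⟨ sym (ℤP.+-identityˡ (- (- i))) ⟩
      0ℤ - (- i)
        ≡⟨ cong₂ _-_ (sym (ℤP.i≤j⇒i⊔j≡j i≤0)) (sym (ℤP.i≥j⇒i⊔j≡i (ℤP.neg-mono-≤ i≤0))) ⟩
      (i ⊔ 0ℤ) - ((- i) ⊔ 0ℤ) ∎
      where open ≡-Reasoning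
    ... | inj₂ 0≤i = begin
      i                  ≡⟨ sym (ℤP.+-identityʳ i) ⟩
      i - 0ℤ
        ≡⟨ cong₂ _-_ (sym (ℤP.i≥j⇒i⊔j≡i 0≤i)) (sym (ℤP.i≤j⇒i⊔j≡j (ℤP.neg-mono-≤ 0≤i))) ⟩
      (i ⊔ 0ℤ) - ((- i) ⊔ 0ℤ) ∎
      where open ≡-Reasoning

  above below : (Fin n → ℤ) → ℤ → Fin n → ℤ
  above f τ x = (f x - τ) ⊔ 0ℤ
  below f τ x = (τ - f x) ⊔ 0ℤ

  above-nonneg : ∀ f τ x → 0ℤ ≤ above f τ x
  above-nonneg f τ x = ⊔0-nonneg (f x - τ)

  below-nonneg : ∀ f τ x → 0ℤ ≤ below f τ x
  below-nonneg f τ x = ⊔0-nonneg (τ - f x)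

  above-zero : ∀ f τ {x} → f x ≤ τ → above f τ x ≡ 0ℤ
  above-zero f τ fx≤τ = ℤP.i≤j⇒i⊔j≡j (ℤP.i≤j⇒i-j≤0 fx≤τ)

  below-zero : ∀ f τ {x} → τ ≤ f x → below f τ x ≡ 0ℤ
  below-zero f τ τ≤fx = ℤP.i≤j⇒i⊔j≡j (ℤP.i≤j⇒i-j≤0 τ≤fx)

  above-pos : ∀ f τ {x} → τ < f x → 0ℤ < above f τ x
  above-pos f τ {x} τ<fx = subst (0ℤ <_) (sym (ℤP.i≥j⇒i⊔j≡i (ℤP.<⇒≤ 0<d))) 0<d
    where
    0<d = <⇒0<- τ<fx

  below-pos : ∀ f τ {x} → f x < τ → 0ℤ < below f τ x
  below-pos f τ {x} fx<τ = subst (0ℤ <_) (sym (ℤP.i≥j⇒i⊔j≡i (ℤP.<⇒≤ 0<d))) 0<d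
    where
    0<d = <⇒0<- fx<τ

  f≡τ+above-below : ∀ f τ x → f x ≡ τ + above f τ x - below f τ x
  f≡τ+above-below f τ x = begin
    f x                                  ≡⟨ shift (f x) τ ⟩
    τ + (f x - τ)                        ≡⟨ cong (_+_ τ) (⊔0-split (f x - τ)) ⟩
    τ + ((f x - τ) ⊔ 0ℤ - ((- (f x - τ)) ⊔ 0ℤ))
                                         ≡⟨ cong (λ t → τ + ((f x - τ) ⊔ 0ℤ - (t ⊔ 0ℤ))) (flip (f x) τ) ⟩
    τ + (above f τ x - below f τ x)      ≡⟨ sym (ℤP.+-assoc τ _ _) ⟩
    τ + above f τ x - below f τ x        ∎
    where
    open ≡-Reasoning
    shift : ∀ a t → a ≡ t + (a - t)
    shift = solve-∀
    flip : ∀ a t → - (a - t) ≡ t - a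
    flip = solve-∀

  atLeast : (Fin n → ℤ) → ℤ → Fin n → Bool
  atLeast f τ w = ⌊ τ ℤP.≤? f w ⌋

  atLeast-true : ∀ f τ {w} → τ ≤ f w → atLeast f τ w ≡ true
  atLeast-true f τ {w} τ≤fw with τ ℤP.≤? f w
  ... | yes _   = refl
  ... | no  τ≰fw = ⊥-elim (τ≰fw τ≤fw)

  atLeast-false : ∀ f τ {w} → f w < τ → atLeast f τ w ≡ false
  atLeast-false f τ {w} fw<τ with τ ℤP.≤? f w
  ... | yes τ≤fw = ⊥-elim (ℤP.<⇒≱ fw<τ τ≤fw)
  ... | no  _    = refl

  module Truncated {Q P f : Fin n → ℤ} (P≡Q-Δf : ∀ w → P w ≡ Q w - Δ f w) (τ : ℤ) where

    truncate : Fin n → ℤ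
    truncate w = Q w - Δ (above f τ) w

    truncate≡ : ∀ w → truncate w ≡ P w - Δ (below f τ) w
    truncate≡ w = begin
      Q w - Δ A w                      ≡⟨ regroup (Q w) (Δ A w) (Δ B w) ⟩
      (Q w - (Δ A w - Δ B w)) - Δ B w
        ≡⟨ cong (λ t → (Q w - t) - Δ B w) (sym (Δ-affine f A B τ (f≡τ+above-below f τ) w)) ⟩
      (Q w - Δ f w) - Δ B w            ≡⟨ cong (_- Δ B w) (sym (P≡Q-Δf w)) ⟩
      P w - Δ B w                      ∎
      where
      open ≡-Reasoning
      A = above f τ
      B = below f τ
      regroup : ∀ q a b → q - a ≡ (q - (a - b)) - b
      regroup = solve-∀

    Q≤truncate : ∀ {w} → f w ≤ τ → Q w ≤ truncate w
    Q≤truncate {w} fw≤τ = ≤-minus-nonpos (Q w) (Δ-nonpos-at-minimum (above f τ) w minimum)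
      where
      minimum : ∀ x → above f τ w ≤ above f τ x
      minimum x = subst (_≤ above f τ x) (sym (above-zero f τ fw≤τ)) (above-nonneg f τ x)

    P≤truncate : ∀ {w} → τ ≤ f w → P w ≤ truncate w
    P≤truncate {w} τ≤fw = subst (P w ≤_) (sym (truncate≡ w))
                                (≤-minus-nonpos (P w) (Δ-nonpos-at-minimum (below f τ) w minimum))
      where
      minimum : ∀ x → below f τ w ≤ below f τ x
      minimum x = subst (_≤ below f τ x) (sym (below-zero f τ τ≤fw)) (below-nonneg f τ x)

    truncate-effective : Effective G Q → Effective G P → Effective G truncate
    truncate-effective Q≥0 P≥0 w with ℤP.≤-total (f w) τ
    ... | inj₁ fw≤τ = ℤP.≤-trans (Q≥0 w) (Q≤truncate fw≤τ)
    ... | inj₂ τ≤fw = ℤP.≤-trans (P≥0 w) (P≤truncate τ≤fw)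

    ∣levelCut∣≤deg : Effective G Q → Effective G P → + ∣ levelCut (atLeast f τ) ∣ ≤ sumFℤ Q
    ∣levelCut∣≤deg Q≥0 P≥0 = begin
      + ∣ levelCut A ∣                           ≡⟨ ∣select∣ (crossing (λ _ → true) A) ⟩
      sumFℤ (λ e → keepIf (A (src e) xor A (tgt e)) 1ℤ)
                                                 ≤⟨ ∑-mono-≤ (λ e → cut-edge (src e) (tgt e)) ⟩
      sumFℤ (outflow A f)                        ≡⟨ sym (∑-outflow A f) ⟩
      sumFℤ (λ w → keepIf (A w) (Δ f w))         ≤⟨ ∑-mono-≤ (λ w → bounded (A w) w) ⟩
      sumFℤ Q                                          ∎
      where
      open ℤP.≤-Reasoning
      A = atLeast f τ
      cut-edge : ∀ a b → keepIf (⌊ τ ℤP.≤? f a ⌋ xor ⌊ τ ℤP.≤? f b ⌋) 1ℤ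
                         ≤ keepIf ⌊ τ ℤP.≤? f a ⌋ (f a - f b) + keepIf ⌊ τ ℤP.≤? f b ⌋ (f b - f a)
      cut-edge a b with τ ℤP.≤? f a | τ ℤP.≤? f b
      ... | yes _    | yes _    = ℤP.≤-reflexive (sym (opposite (f a) (f b)))
        where
        opposite : ∀ x y → (x - y) + (y - x) ≡ 0ℤ
        opposite = solve-∀
      ... | yes τ≤fa | no  τ≰fb = subst (1ℤ ≤_) (sym (ℤP.+-identityʳ _))
                                        (<⇒1≤- (ℤP.<-≤-trans (ℤP.≰⇒> τ≰fb) τ≤fa))
      ... | no  τ≰fa | yes τ≤fb = subst (1ℤ ≤_) (sym (ℤP.+-identityˡ _))
                                        (<⇒1≤- (ℤP.<-≤-trans (ℤP.≰⇒> τ≰fa) τ≤fb))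
      ... | no  _    | no  _    = ℤP.≤-refl
      bounded : ∀ t w → keepIf t (Δ f w) ≤ Q w
      bounded true  w = ℤP.0≤i-j⇒j≤i (subst (0ℤ ≤_) (P≡Q-Δf w) (P≥0 w))
      bounded false w = Q≥0 w

module OrderBound (G : Graph) {r : ℕ} (1≤r : 1 ℕ.≤ r) (S : Scramble G r) where
  open Graph G
  open Summation
  open Laplacian G
  open Cuts G
  open Truncation G
  open Threshold using (IsThreshold)
  open Data.Integer using (-_; _+_; _-_; _≤_; _<_)

  count : (Fin n → ℤ) → Subset n → ℤ
  count X Y = sumFℤ (λ v → keepIf (inside Y v) (X v))

  Misses : (Fin n → ℤ) → Subset n → Set
  Misses X Y = count X Y < + r

  count-mono : ∀ {X X′ Y} → (∀ y → y ∈ Y → X y ≤ X′ y) → count X Y ≤ count X′ Y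
  count-mono {X} {X′} {Y} X≤X′ = ∑-mono-≤ pointwise
    where
    pointwise : ∀ v → keepIf (inside Y v) (X v) ≤ keepIf (inside Y v) (X′ v)
    pointwise v with v ∈? Y
    ... | yes v∈Y = X≤X′ v v∈Y
    ... | no  _   = ℤP.≤-refl

  support : (Fin n → ℤ) → Fin n → Bool
  support h v = ⌊ 0ℤ ℤP.<? h v ⌋

  private
    support-false : ∀ h {v} → 0ℤ ≤ h v → support h v ≡ false → h v ≡ 0ℤ
    support-false h {v} 0≤hv _ with 0ℤ ℤP.<? h v
    support-false h       0≤hv () | yes _
    ... | no 0≮hv = ℤP.≤-antisym (ℤP.≮⇒≥ 0≮hv) 0≤hv

    support-true : ∀ h {v} → support h v ≡ true → 1ℤ ≤ h v
    support-true h {v} _ with 0ℤ ℤP.<? h v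
    ... | yes 0<hv = ℤP.i<j⇒suc[i]≤j 0<hv
    support-true h () | no _

    support-zero : ∀ h {v} → h v ≡ 0ℤ → support h v ≡ false
    support-zero h {v} hv≡0 with 0ℤ ℤP.<? h v
    ... | yes 0<hv = ⊥-elim (ℤP.<-irrefl (sym hv≡0) 0<hv)
    ... | no  _    = refl

    support-pos : ∀ h {v} → 0ℤ < h v → support h v ≡ true
    support-pos h {v} 0<hv with 0ℤ ℤP.<? h v
    ... | yes _    = refl
    ... | no  0≮hv = ⊥-elim (0≮hv 0<hv)

    neg-0- : ∀ x → - (0ℤ - x) ≡ x
    neg-0- = solve-∀

    endpoint-bound : ∀ ya yb pa pb {ha hb} → 0ℤ ≤ hb →
                     (pa ≡ false → ha ≡ 0ℤ) → (pb ≡ true → 1ℤ ≤ hb) →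
                     keepIf ((ya ∧ not pa) ∧ yb ∧ pb) 1ℤ ≤ - keepIf (ya ∧ not pa) (ha - hb)
    endpoint-bound false _     _     _     _    _    _    = ℤP.≤-refl
    endpoint-bound true  _     true  _     _    _    _    = ℤP.≤-refl
    endpoint-bound true  false false _     0≤hb ha≡0 _    rewrite ha≡0 refl =
      subst (0ℤ ≤_) (sym (neg-0- _)) 0≤hb
    endpoint-bound true  true  false false 0≤hb ha≡0 _    rewrite ha≡0 refl =
      subst (0ℤ ≤_) (sym (neg-0- _)) 0≤hb
    endpoint-bound true  true  false true  _    ha≡0 1≤hb rewrite ha≡0 refl =
      subst (1ℤ ≤_) (sym (neg-0- _)) (1≤hb refl)

    crossing-split : ∀ ya yb pa pb → keepIf (ya ∧ yb ∧ (pa xor pb)) 1ℤ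
                     ≡ keepIf ((ya ∧ not pa) ∧ yb ∧ pb) 1ℤ + keepIf ((yb ∧ not pb) ∧ ya ∧ pa) 1ℤ
    crossing-split false false _     _     = refl
    crossing-split false true  _     true  = refl
    crossing-split false true  _     false = refl
    crossing-split true  false true  _     = refl
    crossing-split true  false false _     = refl
    crossing-split true  true  true  true  = refl
    crossing-split true  true  true  false = refl
    crossing-split true  true  false true  = refl
    crossing-split true  true  false false = refl

  -- Inside an r-edge-connected set Y, at least r edges join the zero set of
  -- h ≥ 0 to its support, and each of them feeds X - Δ h on the zero set.
  r≤count-across-support : ∀ {X h} → Effective G X → (∀ x → 0ℤ ≤ h x) →
    Effective G (λ w → X w - Δ h w) → ∀ {Y} → EdgeConnected G r Y →
    ∀ {y y′} → y ∈ Y → y′ ∈ Y → h y ≡ 0ℤ → 0ℤ < h y′ → + r ≤ count (λ w → X w - Δ h w) Y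
  r≤count-across-support {X} {h} X≥0 h≥0 X-Δh≥0 {Y} conn {y} {y′} y∈Y y′∈Y hy≡0 0<hy′ = begin
    + r
      ≤⟨ +≤+ (r≤∣crossing∣ P conn y∈Y y′∈Y (support-zero h hy≡0) (support-pos h 0<hy′)) ⟩
    + ∣ select (crossing (inside Y) P) ∣             ≡⟨ ∣select∣ (crossing (inside Y) P) ⟩
    sumFℤ (λ e → keepIf (crossing (inside Y) P e) 1ℤ) ≤⟨ ∑-mono-≤ edge ⟩
    sumFℤ (λ e → - outflow Z h e)                   ≡⟨ ∑-neg (outflow Z h) ⟩
    - sumFℤ (outflow Z h)                           ≡⟨ cong -_ (sym (∑-outflow Z h)) ⟩
    - sumFℤ (λ w → keepIf (Z w) (Δ h w))            ≡⟨ sym (∑-neg (λ w → keepIf (Z w) (Δ h w))) ⟩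
    sumFℤ (λ w → - keepIf (Z w) (Δ h w))            ≤⟨ ∑-mono-≤ (λ w → vertex (inside Y w) (P w) w) ⟩
    count (λ w → X w - Δ h w) Y                     ∎
    where
    open ℤP.≤-Reasoning
    P = support h
    Z : Fin n → Bool
    Z w = inside Y w ∧ not (P w)
    edge : ∀ e → keepIf (crossing (inside Y) P e) 1ℤ ≤ - outflow Z h e
    edge e = begin
      keepIf (crossing (inside Y) P e) 1ℤ
        ≡⟨ crossing-split (inside Y a) (inside Y b) (P a) (P b) ⟩
      keepIf (Z a ∧ inside Y b ∧ P b) 1ℤ + keepIf (Z b ∧ inside Y a ∧ P a) 1ℤ
        ≤⟨ ℤP.+-mono-≤ (endpoint-bound (inside Y a) (inside Y b) (P a) (P b) (h≥0 b)
                                       (support-false h (h≥0 a)) (support-true h))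
                       (endpoint-bound (inside Y b) (inside Y a) (P b) (P a) (h≥0 a)
                                       (support-false h (h≥0 b)) (support-true h)) ⟩
      - keepIf (Z a) (h a - h b) + - keepIf (Z b) (h b - h a)
        ≡⟨ sym (ℤP.neg-distrib-+ (keepIf (Z a) (h a - h b)) (keepIf (Z b) (h b - h a))) ⟩
      - outflow Z h e
        ∎
      where
      a = src e
      b = tgt e
    vertex : ∀ y p w → - keepIf (y ∧ not p) (Δ h w) ≤ keepIf y (X w - Δ h w)
    vertex false _     w = ℤP.≤-refl
    vertex true  true  w = X-Δh≥0 w
    vertex true  false w = subst (_≤ X w - Δ h w) (ℤP.+-identityˡ (- Δ h w)) (ℤP.+-monoˡ-≤ (- Δ h w) (X≥0 w))

  count-≥-point : ∀ {X Y y} → Effective G X → y ∈ Y → X y ≤ count X Y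
  count-≥-point {X} {Y} {y} X≥0 y∈Y =
    subst (_≤ count X Y) (cong (λ t → keepIf t (X y)) (inside-∈ y∈Y))
          (term≤∑ (λ v → keepIf (inside Y v) (X v)) nonneg y)
    where
    nonneg : ∀ v → 0ℤ ≤ keepIf (inside Y v) (X v)
    nonneg v with inside Y v
    ... | true  = X≥0 v
    ... | false = ℤP.≤-refl

  module _ {g : ℕ} (noCut : ∀ F → ∣ F ∣ ℕ.≤ g → ¬ EggCut G S F) where

    module _ {Q P f : Fin n → ℤ} (P≡Q-Δf : ∀ w → P w ≡ Q w - Δ f w)
             (Q≥0 : Effective G Q) (P≥0 : Effective G P) (degQ : sumFℤ Q ≡ + g)
             {τ : ℤ} (τ-threshold : IsThreshold f (eggs S) τ) where

      open Truncated {Q} {P} {f} P≡Q-Δf τ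

      private
        T = truncate

        T≥0 : Effective G T
        T≥0 = truncate-effective Q≥0 P≥0

      no-egg-below-threshold : ∀ {Y} → Y ∈ˡ eggs S → ¬ (∀ y → y ∈ Y → f y < τ)
      no-egg-below-threshold {Y} Y∈ low with proj₂ τ-threshold | eggs-ne S Y Y∈
      ... | Ŷ , Ŷ∈ , high | y , y∈Y with eggs-ne S Ŷ Ŷ∈
      ... | ŷ , ŷ∈Ŷ = noCut (levelCut A) cut-size
        ( Y , Ŷ , Y∈ , Ŷ∈ , y , ŷ , y∈Y , ŷ∈Ŷ
        , (λ x x∈Y → levelCut-within A false 1≤r (eggs-conn S Y Y∈)
                                     (λ z z∈Y → atLeast-false f τ (low z z∈Y)) y∈Y x∈Y)
        , (λ x x∈Ŷ → levelCut-within A true 1≤r (eggs-conn S Ŷ Ŷ∈)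
                                     (λ z z∈Ŷ → atLeast-true f τ (high z z∈Ŷ)) ŷ∈Ŷ x∈Ŷ)
        , levelCut-separates A (atLeast-false f τ (low y y∈Y)) (atLeast-true f τ (high ŷ ŷ∈Ŷ)) )
        where
        A = atLeast f τ
        cut-size : ∣ levelCut A ∣ ℕ.≤ g
        cut-size = ℤP.drop‿+≤+ (ℤP.≤-trans (∣levelCut∣≤deg Q≥0 P≥0) (ℤP.≤-reflexive degQ))

      misses⇒≤threshold : ∀ {Y} → Y ∈ˡ eggs S → Misses T Y → ∀ {y} → y ∈ Y → f y ≤ τ
      misses⇒≤threshold {Y} Y∈ miss {y} y∈Y with f y ℤP.≤? τ | proj₁ τ-threshold Y Y∈
      ... | yes fy≤τ | _ = fy≤τ
      ... | no  fy≰τ | z , z∈Y , fz≤τ = ⊥-elim (ℤP.<⇒≱ miss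
        (r≤count-across-support Q≥0 (above-nonneg f τ) T≥0 (eggs-conn S Y Y∈) z∈Y y∈Y
                                (above-zero f τ fz≤τ) (above-pos f τ (ℤP.≰⇒> fy≰τ))))

      misses⇒≥threshold : ∀ {Y} → Y ∈ˡ eggs S → Misses T Y → ∀ {y} → y ∈ Y → τ ≤ f y
      misses⇒≥threshold {Y} Y∈ miss {y} y∈Y with τ ℤP.≤? f y
      ... | yes τ≤fy = τ≤fy
      ... | no  τ≰fy with any? (λ z → (z ∈? Y) ×-dec (τ ℤP.≤? f z))
      ...   | yes (z , z∈Y , τ≤fz) = ⊥-elim (ℤP.<⇒≱ miss (subst (+ r ≤_) (∑-cong T≡) hit))
        where
        T≡ : ∀ v → keepIf (inside Y v) (P v - Δ (below f τ) v) ≡ keepIf (inside Y v) (T v)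
        T≡ v = cong (keepIf (inside Y v)) (sym (truncate≡ v))
        hit : + r ≤ count (λ w → P w - Δ (below f τ) w) Y
        hit = r≤count-across-support P≥0 (below-nonneg f τ)
                (λ w → subst (0ℤ ≤_) (truncate≡ w) (T≥0 w)) (eggs-conn S Y Y∈)
                z∈Y y∈Y (below-zero f τ τ≤fz) (below-pos f τ (ℤP.≰⇒> τ≰fy))
      ...   | no  none =
        ⊥-elim (no-egg-below-threshold Y∈ (λ z z∈Y → ℤP.≰⇒> (λ τ≤fz → none (z , z∈Y , τ≤fz))))

      misses-truncate : ∀ {Y} → Y ∈ˡ eggs S → Misses T Y → Misses Q Y × Misses P Y
      misses-truncate Y∈ miss =
        ℤP.≤-<-trans (count-mono (λ y y∈Y → Q≤truncate (misses⇒≤threshold Y∈ miss y∈Y))) miss ,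
        ℤP.≤-<-trans (count-mono (λ y y∈Y → P≤truncate (misses⇒≥threshold Y∈ miss y∈Y))) miss

  record Member (D : Fin n → ℤ) : Set where
    field
      potential : Fin n → ℤ
      effective : Effective G (λ w → D w - Δ potential w)
  open Member

  ⟦_⟧ : ∀ {D} → Member D → Fin n → ℤ
  ⟦_⟧ {D} M w = D w - Δ (potential M) w

  module _ (D : Fin n → ℤ) {g : ℕ} (deg≡g : sumFℤ D ≡ + g)
           (noCut : ∀ F → ∣ F ∣ ℕ.≤ g → ¬ EggCut G S F) where

    deg⟦_⟧ : ∀ (M : Member D) → sumFℤ ⟦ M ⟧ ≡ + g
    deg⟦ M ⟧ = begin
      sumFℤ (λ w → D w - Δ (potential M) w)  ≡⟨ ∑-minus D (Δ (potential M)) ⟩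
      sumFℤ D - sumFℤ (Δ (potential M))      ≡⟨ cong₂ _-_ deg≡g (∑-Δ (potential M)) ⟩
      + g - 0ℤ                               ≡⟨ ℤP.+-identityʳ (+ g) ⟩
      + g                                    ∎
      where open ≡-Reasoning

    difference : Member D → Member D → Fin n → ℤ
    difference M₁ M₂ x = potential M₂ x - potential M₁ x

    ⟦⟧-difference : ∀ (M₁ M₂ : Member D) w → ⟦ M₂ ⟧ w ≡ ⟦ M₁ ⟧ w - Δ (difference M₁ M₂) w
    ⟦⟧-difference M₁ M₂ w = begin
      D w - Δ p₂ w                        ≡⟨ regroup (D w) (Δ p₁ w) (Δ p₂ w) ⟩
      (D w - Δ p₁ w) - (Δ p₂ w - Δ p₁ w)
        ≡⟨ cong (_-_ (D w - Δ p₁ w)) (sym (Δ-affine _ p₂ p₁ 0ℤ shift w)) ⟩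
      (D w - Δ p₁ w) - Δ (difference M₁ M₂) w ∎
      where
      open ≡-Reasoning
      p₁ = potential M₁
      p₂ = potential M₂
      regroup : ∀ d a b → d - b ≡ (d - a) - (b - a)
      regroup = solve-∀
      zero+ : ∀ a b → a - b ≡ 0ℤ + a - b
      zero+ = solve-∀
      shift : ∀ x → difference M₁ M₂ x ≡ 0ℤ + p₂ x - p₁ x
      shift x = zero+ (p₂ x) (p₁ x)

    ⟦⟧-+ : ∀ (M : Member D) h w → D w - Δ (λ x → potential M x + h x) w ≡ ⟦ M ⟧ w - Δ h w
    ⟦⟧-+ M h w = trans (cong (_-_ (D w)) (Δ-+ (potential M) h w)) (regroup (D w) _ _)
      where
      regroup : ∀ d a b → d - (a + b) ≡ (d - a) - b
      regroup = solve-∀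

    truncation : Member D → Member D → ℤ → Member D
    truncation M₁ M₂ τ = record
      { potential = λ x → potential M₁ x + above (difference M₁ M₂) τ x
      ; effective = λ w → subst (0ℤ ≤_) (sym (⟦⟧-+ M₁ (above (difference M₁ M₂) τ) w))
                                (truncate-effective (effective M₁) (effective M₂) w)
      }
      where open Truncated {⟦ M₁ ⟧} {⟦ M₂ ⟧} {difference M₁ M₂} (⟦⟧-difference M₁ M₂) τ

    Refines : Member D → Member D → Set
    Refines M M′ = ∀ Y → Y ∈ˡ eggs S → Misses ⟦ M ⟧ Y → Misses ⟦ M′ ⟧ Y

    eggThreshold : ∀ f → eggs S ≡ [] ⊎ ∃[ τ ] IsThreshold f (eggs S) τ
    eggThreshold f with eggs S | eggs-ne S
    ... | []     | _        = inj₁ refl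
    ... | Y ∷ Ys | nonempty =
      inj₂ (Threshold.threshold f Y Ys (nonempty Y (here refl)) (λ Y′ Y′∈ → nonempty Y′ (there Y′∈)))

    combine : ∀ M₁ M₂ → Σ (Member D) λ M → Refines M M₁ × Refines M M₂
    combine M₁ M₂ with eggThreshold (difference M₁ M₂)
    ... | inj₁ noEggs = M₁ , (λ _ _ miss → miss) , λ Y Y∈ → ⊥-elim (¬Any[] (subst (Y ∈ˡ_) noEggs Y∈))
    ... | inj₂ (τ , τ-threshold) =
      truncation M₁ M₂ τ , (λ Y Y∈ miss → proj₁ (misses Y∈ (as-truncate Y miss)))
                         , (λ Y Y∈ miss → proj₂ (misses Y∈ (as-truncate Y miss)))
      where
      A = above (difference M₁ M₂) τ
      as-truncate : ∀ Y → Misses ⟦ truncation M₁ M₂ τ ⟧ Y → Misses (λ w → ⟦ M₁ ⟧ w - Δ A w) Y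
      as-truncate Y = subst (_< + r) (∑-cong (λ v → cong (keepIf (inside Y v)) (⟦⟧-+ M₁ A v)))
      misses = misses-truncate noCut {⟦ M₁ ⟧} {⟦ M₂ ⟧} {difference M₁ M₂} (⟦⟧-difference M₁ M₂)
                               (effective M₁) (effective M₂) deg⟦ M₁ ⟧ τ-threshold

    refine : Member D → (Ms : List (Member D)) →
             Σ (Member D) λ M →
               ∀ Y → Y ∈ˡ eggs S → Misses ⟦ M ⟧ Y → All (λ M′ → Misses ⟦ M′ ⟧ Y) Ms
    refine M₀ []        = M₀ , λ _ _ _ → []
    refine M₀ (M₁ ∷ Ms) with refine M₀ Ms
    ... | M , M-refines with combine M M₁
    ... | M′ , M′⇒M , M′⇒M₁ =
      M′ , λ Y Y∈ miss → M′⇒M₁ Y Y∈ miss ∷ M-refines Y Y∈ (M′⇒M Y Y∈ miss)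

    pointMass : Fin n → Multiset G
    pointMass v x = if ⌊ v ≟ x ⌋ then r else 0

    size-pointMass : ∀ v → size G (pointMass v) ≡ r
    size-pointMass v = ℤP.+-injective (begin
      + sumF (pointMass v)                   ≡⟨ sym (∑-pos (pointMass v)) ⟩
      sumFℤ (λ x → + pointMass v x)          ≡⟨ ∑-cong (λ x → cast ⌊ v ≟ x ⌋) ⟩
      sumFℤ (λ x → keepIf ⌊ v ≟ x ⌋ (+ r))   ≡⟨ ∑-point v (+ r) ⟩
      + r                                    ∎)
      where
      open ≡-Reasoning
      cast : ∀ t → + (if t then r else 0) ≡ keepIf t (+ r)
      cast true  = refl
      cast false = refl

    pointMass-self : ∀ v → pointMass v v ≡ r
    pointMass-self v with v ≟ v
    ... | yes _   = refl
    ... | no  v≢v = ⊥-elim (v≢v refl)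

    pointMember : RankAtLeast G r D → ∀ v → Σ (Member D) λ M → + r ≤ ⟦ M ⟧ v
    pointMember rank v with rank (pointMass v) (size-pointMass v)
    ... | D′ , D-rv~D′ , D′≥0 with ~⇒Δ D-rv~D′
    ... | φ , D′≡ = record { potential = φ ; effective = effective′ } , at-v
      where
      restore : ∀ d p l → d - l ≡ (d - p - l) + p
      restore = solve-∀
      ⟦⟧≡ : ∀ w → D w - Δ φ w ≡ D′ w + + pointMass v w
      ⟦⟧≡ w = trans (restore (D w) (+ pointMass v w) (Δ φ w)) (cong (λ t → t + + pointMass v w) (sym (D′≡ w)))
      effective′ : Effective G (λ w → D w - Δ φ w)
      effective′ w = subst (0ℤ ≤_) (sym (⟦⟧≡ w)) (ℤP.+-mono-≤ (D′≥0 w) (+≤+ ℕ.z≤n))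
      at-v : + r ≤ D v - Δ φ v
      at-v = subst (+ r ≤_) (sym (trans (⟦⟧≡ v) (cong (λ k → D′ v + + k) (pointMass-self v))))
                   (ℤP.+-monoˡ-≤ (+ r) (D′≥0 v))

    absolute : Member D → Multiset G
    absolute M w = Data.Integer.∣ ⟦ M ⟧ w ∣

    size-absolute : ∀ M → size G (absolute M) ≡ g
    size-absolute M = ℤP.+-injective (begin
      + sumF (absolute M)               ≡⟨ sym (∑-pos (absolute M)) ⟩
      sumFℤ (λ w → + absolute M w)      ≡⟨ ∑-cong (λ w → ℤP.0≤i⇒+∣i∣≡i (effective M w)) ⟩
      sumFℤ ⟦ M ⟧                       ≡⟨ deg⟦ M ⟧ ⟩
      + g                               ∎)
      where open ≡-Reasoning

    count-absolute : ∀ M Y → + restrictCount G (absolute M) Y ≡ count ⟦ M ⟧ Y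
    count-absolute M Y = trans (sym (∑-pos (λ v → if ⌊ v ∈? Y ⌋ then absolute M v else 0))) (∑-cong cast)
      where
      cast : ∀ v → + (if ⌊ v ∈? Y ⌋ then absolute M v else 0) ≡ keepIf (inside Y v) (⟦ M ⟧ v)
      cast v with v ∈? Y
      ... | yes _ = ℤP.0≤i⇒+∣i∣≡i (effective M v)
      ... | no  _ = refl

    refines-points⇒hits : ∀ (points : ∀ v → Σ (Member D) λ P → + r ≤ ⟦ P ⟧ v) M →
      (∀ Y → Y ∈ˡ eggs S → Misses ⟦ M ⟧ Y → ∀ v → Misses ⟦ proj₁ (points v) ⟧ Y) →
      Hits G S (absolute M)
    refines-points⇒hits points M refines Y Y∈ with r ℕP.≤? restrictCount G (absolute M) Y
    ... | yes r≤ = r≤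
    ... | no  r≰ =
      ⊥-elim (ℤP.<⇒≱ (refines Y Y∈ M-misses y) (ℤP.≤-trans r≤Py (count-≥-point (effective P) y∈Y)))
      where
      M-misses : Misses ⟦ M ⟧ Y
      M-misses = subst (_< + r) (count-absolute M Y) (+<+ (ℕP.≰⇒> r≰))
      y = proj₁ (eggs-ne S Y Y∈)
      y∈Y = proj₂ (eggs-ne S Y Y∈)
      P = proj₁ (points y)
      r≤Py = proj₂ (points y)

    hitting-multiset : RankAtLeast G r D → ∃[ C ] size G C ≡ g × Hits G S C
    hitting-multiset rank = absolute M , size-absolute M , refines-points⇒hits points M refines
      where
      points = pointMember rank
      refinement = refine (proj₁ (points (proj₁ nonempty))) (map (λ v → proj₁ (points v)) (allFin n))
      M = proj₁ refinement
      refines : ∀ Y → Y ∈ˡ eggs S → Misses ⟦ M ⟧ Y → ∀ v → Misses ⟦ proj₁ (points v) ⟧ Y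
      refines Y Y∈ miss v = All.lookup (map⁻ (proj₂ refinement Y Y∈ miss)) (∈-allFin v)

  order≤degree : ∀ {k} → IsOrder G S k → ∀ D {g} → deg G D ≡ + g → RankAtLeast G r D → k ℕ.≤ g
  order≤degree {k} (_ , least) D {g} deg≡g rank with k ℕP.≤? g
  ... | yes k≤g = k≤g
  ... | no  k≰g = least g (inj₁ (hitting-multiset D deg≡g noCut rank))
    where
    noCut : ∀ F → ∣ F ∣ ℕ.≤ g → ¬ EggCut G S F
    noCut F ∣F∣≤g cut = k≰g (ℕP.≤-trans (least ∣ F ∣ (inj₂ (F , refl , cut))) ∣F∣≤g)

open import Data.Nat using (_≤_)

theorem5p2 : (G : Graph) (r : ℕ) → 1 ≤ r →
    ∀ s g → IsScrambleNumber G r s → IsGonality G r g → s ≤ g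
theorem5p2 G r 1≤r s g ((S , order≡s) , _) ((D , deg≡g , rank) , _) =
  OrderBound.order≤degree G 1≤r S order≡s D deg≡g rank
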